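{- Let $C_n$ denote the cycle on $n$ vertices. For every $n\ge 7$, $$D_t(C_n,x)=x\,D_t(C_{n-1},x)+x^2D_t(C_{n-3},x)+x^2D_t(C_{n-4},x).$$
   Context: A set $D\subseteq V(G)$ of a finite simple graph $G$ is a total dominating set if every vertex of $G$ is adjacent to some vertex of $D$. With $d_t(G,i)$ the number of total dominating sets of size $i$, the total domination polynomial is $D_t(G,x)=\sum_{i=1}^{|V(G)|}d_t(G,i)x^i$. -}

module Defs where

open import Data.Nat using (ℕ; zero; suc; _+_; _∸_; _%_; _≡ᵇ_)
open import Data.Bool using (Bool; true; false; _∨_; _∧_; if_then_else_)
open import Data.Fin using (Fin; toℕ)
open import Data.Fin.Subset using (Subset; ∣_∣; _∈_)
open import Data.Vec using (Vec; []; _∷_)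
open import Data.List using (List; []; _∷_; map; _++_; length; filter)
open import Data.Product using (Σ; _,_; _×_)
open import Relation.Nullary using (Dec; yes; no; ¬_)
open import Relation.Binary.PropositionalEquality using (_≡_)

-- A graph on vertex set Fin n, given by its Boolean adjacency relation.
-- (Only used for cycles C_n with n ≥ 3, which are simple graphs.)
Graph : ℕ → Set
Graph n = Fin n → Fin n → Bool

allSubsets : (n : ℕ) → List (Subset n)
allSubsets zero = [] ∷ []
allSubsets (suc n) = map (false ∷_) (allSubsets n) ++ map (true ∷_) (allSubsets n)

member : ∀ {n} → Fin n → Subset n → Bool
member Fin.zero (b ∷ _) = b
member (Fin.suc i) (_ ∷ p) = member i p

anyFin : ∀ {n} → (Fin n → Bool) → Bool
anyFin {zero} f = false
anyFin {suc n} f = f Fin.zero ∨ anyFin (λ i → f (Fin.suc i))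

allFin : ∀ {n} → (Fin n → Bool) → Bool
allFin {zero} f = true
allFin {suc n} f = f Fin.zero ∧ allFin (λ i → f (Fin.suc i))

isTotalDominating : ∀ {n} → Graph n → Subset n → Bool
isTotalDominating G D = allFin (λ v → anyFin (λ u → member u D ∧ G v u))

dt : ∀ {n} → Graph n → ℕ → ℕ
dt {n} G i = length (filter (λ D → (∣ D ∣ ≡ᵇ i) Data.Bool.≟ true)
                           (filter (λ D → isTotalDominating G D Data.Bool.≟ true) (allSubsets n)))

-- Coefficient of x^i in D_t(G,x) = Σ_{i=1}^{|V|} d_t(G,i) x^i (constant term 0).
Dt-coeff : ∀ {n} → Graph n → ℕ → ℕ
Dt-coeff G zero = 0
Dt-coeff G (suc i) = dt G (suc i)

-- Cycle C_n for n ≥ 3: vertices 0..n-1, i ~ j iff j ≡ i+1 (mod n) or i ≡ j+1 (mod n).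
cycleAdj : (n : ℕ) → Fin n → Fin n → Bool
cycleAdj n i j = (suc (toℕ i) % suc (n ∸ 1) ≡ᵇ toℕ j) ∨ (suc (toℕ j) % suc (n ∸ 1) ≡ᵇ toℕ i)

C : (n : ℕ) → Graph n
C n = cycleAdj n

-- Coefficients of x^k · p(x): shift k p i = p (i - k) if i ≥ k, else 0.
shift : ℕ → (ℕ → ℕ) → ℕ → ℕ
shift zero p i = p i
shift (suc k) p zero = 0
shift (suc k) p (suc i) = shift k p i

-- Read a subset of C_n as a bit string b₀ b₁ … b₍ₙ₋₁₎, remembering the last two bits
-- p q: the vertex of q is dominated iff p or the next bit is set.  This is a transfer
-- matrix on the four states (p, q) with entries 0, 1 and x; its characteristic
-- polynomial is λ⁴ − xλ³ − x²λ − x², so every entry of its k-th power satisfies the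
-- recurrence.  Fixing b₀ b₁ and closing the cycle against them writes D_t(C_n, x) as a
-- sum of such entries (k = n − 2) times x^(b₀ + b₁).
module Submission where

open import Defs
open import Data.Nat using (ℕ; zero; suc; _+_; _∸_; _≥_; _<_; _%_; _≡ᵇ_; s≤s; z≤n)
open import Data.Nat.Properties using (+-comm; ≡ᵇ⇒≡; ≡⇒≡ᵇ; ≤-refl; m≤n⇒m≤1+n; m≤n⇒m<n∨m≡n)
open import Data.Nat.DivMod using (n%n≡0; m<n⇒m%n≡m; m%n<n)
open import Data.Nat.Tactic.RingSolver using (solve-∀)
open import Data.Bool using (Bool; true; false; _∨_; _∧_; T; _≟_)
open import Data.Bool.Properties using (T-∧; T-∨; T-≡; ⇔→≡)
open import Data.Fin using (Fin; toℕ; fromℕ<)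
open import Data.Fin.Properties using (toℕ-fromℕ<; toℕ<n)
open import Data.Fin.Subset using (Subset; ∣_∣)
open import Data.Vec using ([]; _∷_)
open import Data.List using (List; []; _∷_; map; _++_; length; filter)
open import Data.List.Properties using (filter-++; filter-≐; filter-none; length-++; length-map)
open import Data.List.Relation.Unary.All using (universal)
open import Data.Product using (∃; _×_; _,_)
open import Data.Sum using (_⊎_; inj₁; inj₂)
open import Data.Unit using (tt)
open import Function using (_∘_; _⇔_; mk⇔; Equivalence)
open import Function.Construct.Composition using (_⇔-∘_)
open import Function.Construct.Symmetry using (⇔-sym)
open import Relation.Nullary using (does)
open import Relation.Unary using (Pred; Decidable)
open import Relation.Binary.PropositionalEquality

open Equivalence using (to; from)

Poly : Set
Poly = ℕ → ℕ

infixl 6 _⊕_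
_⊕_ : Poly → Poly → Poly
(f ⊕ g) i = f i + g i

shift-cong : ∀ k {f g : Poly} → f ≗ g → shift k f ≗ shift k g
shift-cong zero    f≗g i       = f≗g i
shift-cong (suc k) f≗g zero    = refl
shift-cong (suc k) f≗g (suc i) = shift-cong k f≗g i

shift-⊕ : ∀ k (f g : Poly) → shift k (f ⊕ g) ≗ shift k f ⊕ shift k g
shift-⊕ zero    f g i       = refl
shift-⊕ (suc k) f g zero    = refl
shift-⊕ (suc k) f g (suc i) = shift-⊕ k f g i

shift-shift : ∀ j k (f : Poly) → shift j (shift k f) ≗ shift (j + k) f
shift-shift zero    k f i       = refl
shift-shift (suc j) k f zero    = refl
shift-shift (suc j) k f (suc i) = shift-shift j k f i

shift-comm : ∀ j k (f : Poly) → shift j (shift k f) ≗ shift k (shift j f)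
shift-comm j k f i = begin
  shift j (shift k f) i  ≡⟨ shift-shift j k f i ⟩
  shift (j + k) f i      ≡⟨ cong (λ l → shift l f i) (+-comm j k) ⟩
  shift (k + j) f i      ≡⟨ shift-shift k j f i ⟨
  shift k (shift j f) i  ∎
  where open ≡-Reasoning

Recurrent : (ℕ → Poly) → Set
Recurrent P = ∀ k → P (4 + k) ≗ shift 1 (P (3 + k)) ⊕ shift 2 (P (1 + k)) ⊕ shift 2 (P k)

recurrent-⊕ : ∀ {P Q} → Recurrent P → Recurrent Q → Recurrent (λ k → P k ⊕ Q k)
recurrent-⊕ {P} {Q} rec-P rec-Q k i = begin
  P (4 + k) i + Q (4 + k) i
    ≡⟨ cong₂ _+_ (rec-P k i) (rec-Q k i) ⟩
  (a + b + c) + (a′ + b′ + c′)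
    ≡⟨ interchange a b c a′ b′ c′ ⟩
  (a + a′) + (b + b′) + (c + c′)
    ≡⟨ cong₂ _+_ (cong₂ _+_ (shift-⊕ 1 _ _ i) (shift-⊕ 2 _ _ i)) (shift-⊕ 2 _ _ i) ⟨
  (shift 1 (PQ (3 + k)) ⊕ shift 2 (PQ (1 + k)) ⊕ shift 2 (PQ k)) i ∎
  where
  open ≡-Reasoning
  PQ : ℕ → Poly
  PQ k = P k ⊕ Q k
  a  = shift 1 (P (3 + k)) i
  b  = shift 2 (P (1 + k)) i
  c  = shift 2 (P k) i
  a′ = shift 1 (Q (3 + k)) i
  b′ = shift 2 (Q (1 + k)) i
  c′ = shift 2 (Q k) i
  interchange : ∀ a b c a′ b′ c′ → (a + b + c) + (a′ + b′ + c′) ≡ (a + a′) + (b + b′) + (c + c′)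
  interchange = solve-∀

recurrent-shift : ∀ j {P} → Recurrent P → Recurrent (λ k → shift j (P k))
recurrent-shift j {P} rec-P k i = begin
  shift j (P (4 + k)) i
    ≡⟨ shift-cong j (rec-P k) i ⟩
  shift j (shift 1 (P (3 + k)) ⊕ shift 2 (P (1 + k)) ⊕ shift 2 (P k)) i
    ≡⟨ shift-⊕ j _ _ i ⟩
  shift j (shift 1 (P (3 + k)) ⊕ shift 2 (P (1 + k))) i + shift j (shift 2 (P k)) i
    ≡⟨ cong (_+ shift j (shift 2 (P k)) i) (shift-⊕ j _ _ i) ⟩
  shift j (shift 1 (P (3 + k))) i + shift j (shift 2 (P (1 + k))) i + shift j (shift 2 (P k)) i
    ≡⟨ cong₂ _+_ (cong₂ _+_ (shift-comm j 1 _ i) (shift-comm j 2 _ i)) (shift-comm j 2 _ i) ⟩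
  shift 1 (shift j (P (3 + k))) i + shift 2 (shift j (P (1 + k))) i + shift 2 (shift j (P k)) i ∎
  where open ≡-Reasoning

filter-map : ∀ {a b p} {A : Set a} {B : Set b} {P : Pred B p} (P? : Decidable P) (f : A → B) (xs : List A) →
             filter P? (map f xs) ≡ map f (filter (P? ∘ f) xs)
filter-map P? f []       = refl
filter-map P? f (x ∷ xs) with does (P? (f x))
... | true  = cong (f x ∷_) (filter-map P? f xs)
... | false = filter-map P? f xs

hasSize? : ∀ {n} i → Decidable (λ (D : Subset n) → (∣ D ∣ ≡ᵇ i) ≡ true)
hasSize? i D = (∣ D ∣ ≡ᵇ i) ≟ true

bySize : ∀ {n} → List (Subset n) → Poly
bySize xs i = length (filter (hasSize? i) xs)

bySize-++ : ∀ {n} (xs ys : List (Subset n)) → bySize (xs ++ ys) ≗ bySize xs ⊕ bySize ys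
bySize-++ xs ys i = trans (cong length (filter-++ (hasSize? i) xs ys)) (length-++ (filter (hasSize? i) xs))

bySize-map-false∷ : ∀ {n} (xs : List (Subset n)) → bySize (map (false ∷_) xs) ≗ bySize xs
bySize-map-false∷ xs i =
  trans (cong length (filter-map (hasSize? i) (false ∷_) xs)) (length-map (false ∷_) (filter (hasSize? i) xs))

bySize-map-true∷ : ∀ {n} (xs : List (Subset n)) → bySize (map (true ∷_) xs) ≗ shift 1 (bySize xs)
bySize-map-true∷ xs zero    = cong length (trans (filter-map (hasSize? 0) (true ∷_) xs)
                                                  (cong (map (true ∷_)) (filter-none _ (universal (λ _ ()) xs))))
bySize-map-true∷ xs (suc i) =
  trans (cong length (filter-map (hasSize? (suc i)) (true ∷_) xs)) (length-map (true ∷_) (filter (hasSize? i) xs))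

-- Shaped so that Dt-coeff G (suc i) is subsetGF (isTotalDominating G) (suc i) by definition.
subsetGF : ∀ {n} → (Subset n → Bool) → Poly
subsetGF {n} P = bySize (filter (λ D → P D ≟ true) (allSubsets n))

subsetGF-cong : ∀ {n} {P Q : Subset n → Bool} → (∀ D → P D ≡ Q D) → subsetGF P ≗ subsetGF Q
subsetGF-cong {n} P≗Q i = cong (λ xs → bySize xs i)
  (filter-≐ _ _ ((λ {D} e → trans (sym (P≗Q D)) e) , (λ {D} e → trans (P≗Q D) e)) (allSubsets n))

subsetGF-false : ∀ {n} → subsetGF {n} (λ _ → false) ≗ λ _ → 0
subsetGF-false {n} i = cong (λ xs → bySize xs i) (filter-none _ (universal (λ _ ()) (allSubsets n)))

subsetGF-split : ∀ {n} (P : Subset (suc n) → Bool) →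
  subsetGF P ≗ subsetGF (λ D → P (false ∷ D)) ⊕ shift 1 (subsetGF (λ D → P (true ∷ D)))
subsetGF-split {n} P i = begin
  bySize (filter P? (map (false ∷_) S ++ map (true ∷_) S)) i
    ≡⟨ cong (λ xs → bySize xs i) (filter-++ P? (map (false ∷_) S) _) ⟩
  bySize (filter P? (map (false ∷_) S) ++ filter P? (map (true ∷_) S)) i
    ≡⟨ bySize-++ (filter P? (map (false ∷_) S)) _ i ⟩
  bySize (filter P? (map (false ∷_) S)) i + bySize (filter P? (map (true ∷_) S)) i
    ≡⟨ cong₂ (λ xs ys → bySize xs i + bySize ys i)
             (filter-map P? (false ∷_) S) (filter-map P? (true ∷_) S) ⟩
  bySize (map (false ∷_) (filter (P? ∘ (false ∷_)) S)) i
    + bySize (map (true ∷_) (filter (P? ∘ (true ∷_)) S)) i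
    ≡⟨ cong₂ _+_ (bySize-map-false∷ (filter (P? ∘ (false ∷_)) S) i)
                 (bySize-map-true∷ (filter (P? ∘ (true ∷_)) S) i) ⟩
  subsetGF (λ D → P (false ∷ D)) i + shift 1 (subsetGF (λ D → P (true ∷ D))) i ∎
  where
  open ≡-Reasoning
  S = allSubsets n
  P? = λ D → P D ≟ true

Family : Set
Family = Bool → Bool → Poly

-- The state (p, q) holds the last two bits read; a new bit r has weight x^r and is
-- admissible unless p = r = false, which would leave the vertex of q undominated.
step : Family → Family
step F false q = shift 1 (F q true)
step F true  q = F q false ⊕ shift 1 (F q true)

step-cong : ∀ {F G : Family} → (∀ p q → F p q ≗ G p q) → ∀ p q → step F p q ≗ step G p q
step-cong F≗G false q i = shift-cong 1 (F≗G q true) i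
step-cong F≗G true  q i = cong₂ _+_ (F≗G q false i) (shift-cong 1 (F≗G q true) i)

+-reverse : ∀ a b c → a + b + c ≡ c + b + a
+-reverse = solve-∀

-- Cayley–Hamilton for the transfer matrix.  After two shifts both sides consist of the
-- same terms, which only need reordering.
step-characteristic : ∀ F p q →
  step (step (step (step F))) p q ≗
    shift 1 (step (step (step F)) p q) ⊕ shift 2 (step F p q) ⊕ shift 2 (F p q)
step-characteristic F false false zero               = refl
step-characteristic F false false (suc zero)         = refl
step-characteristic F false false j@(suc (suc _))    =
  +-reverse (shift 2 (F false false) j) (shift 2 (step F false false) j)
            (shift 1 (step (step (step F)) false false) j)
step-characteristic F false true  zero               = refl
step-characteristic F false true  j@(suc _)          =
  +-reverse (shift 2 (F false true) j) (shift 2 (step F false true) j)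
            (shift 1 (step (step (step F)) false true) j)
step-characteristic F true  false zero               = refl
step-characteristic F true  false (suc zero)         = refl
step-characteristic F true  false (suc (suc i))      =
  rearrange (F true false i) (shift 1 (F true true) i) (F false false i) (shift 1 (F false true) i)
            (shift 1 (step F true true) i)
  where
  rearrange : ∀ a b c d e → a + b + (c + d + e) ≡ b + e + (c + d) + a
  rearrange = solve-∀
step-characteristic F true  true  zero               = refl
step-characteristic F true  true  (suc zero)         = refl
step-characteristic F true  true  j@(suc (suc _))    =
  +-reverse (shift 2 (F true true) j) (shift 2 (step F true true) j)
            (shift 1 (step (step (step F)) true true) j)

transfer : Family → ℕ → Family
transfer F zero    = F
transfer F (suc k) = step (transfer F k)

transfer-recurrent : ∀ F p q → Recurrent (λ k → transfer F k p q)
transfer-recurrent F p q k = step-characteristic (transfer F k) p q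

-- tailDominated s₀ s₁ p q rest: in the cycle s₀ s₁ … p q rest, every vertex from the one
-- carrying q onwards has a chosen neighbour; s₀ s₁ are needed only to close the cycle.
tailDominated : ∀ {k} → Bool → Bool → Bool → Bool → Subset k → Bool
tailDominated s₀ s₁ p q []         = (p ∨ s₀) ∧ (q ∨ s₁)
tailDominated s₀ s₁ p q (r ∷ rest) = (p ∨ r) ∧ tailDominated s₀ s₁ q r rest

cycleDominated : ∀ {k} → Subset (2 + k) → Bool
cycleDominated (b₀ ∷ b₁ ∷ rest) = tailDominated b₀ b₁ b₀ b₁ rest

tailGF : Bool → Bool → ℕ → Family
tailGF s₀ s₁ k p q = subsetGF {k} (tailDominated s₀ s₁ p q)

tailGF-step : ∀ s₀ s₁ k p q → tailGF s₀ s₁ (suc k) p q ≗ step (tailGF s₀ s₁ k) p q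
tailGF-step s₀ s₁ k false q i =
  trans (subsetGF-split (tailDominated {suc k} s₀ s₁ false q) i)
        (cong (_+ shift 1 (tailGF s₀ s₁ k q true) i) (subsetGF-false {k} i))
tailGF-step s₀ s₁ k true  q i = subsetGF-split (tailDominated {suc k} s₀ s₁ true q) i

tailGF-transfer : ∀ s₀ s₁ k p q → tailGF s₀ s₁ k p q ≗ transfer (tailGF s₀ s₁ 0) k p q
tailGF-transfer s₀ s₁ zero    p q i = refl
tailGF-transfer s₀ s₁ (suc k) p q i =
  trans (tailGF-step s₀ s₁ k p q i) (step-cong (tailGF-transfer s₀ s₁ k) p q i)

cycleTerm : ℕ → Bool → Bool → Poly
cycleTerm k b₀ b₁ = transfer (tailGF b₀ b₁ 0) k b₀ b₁

cycleGF : ℕ → Poly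
cycleGF k = cycleTerm k false false ⊕ shift 1 (cycleTerm k false true)
          ⊕ shift 1 (cycleTerm k true false ⊕ shift 1 (cycleTerm k true true))

cycleGF-recurrent : Recurrent cycleGF
cycleGF-recurrent =
  recurrent-⊕ (recurrent-⊕ (term false false) (recurrent-shift 1 (term false true)))
              (recurrent-shift 1 (recurrent-⊕ (term true false) (recurrent-shift 1 (term true true))))
  where
  term : ∀ b₀ b₁ → Recurrent (λ k → cycleTerm k b₀ b₁)
  term b₀ b₁ = transfer-recurrent (tailGF b₀ b₁ 0) b₀ b₁

subsetGF-cycleDominated : ∀ k → subsetGF {2 + k} cycleDominated ≗ cycleGF k
subsetGF-cycleDominated k i = begin
  subsetGF {2 + k} cycleDominated i
    ≡⟨ subsetGF-split (cycleDominated {k}) i ⟩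
  subsetGF (after false) i + shift 1 (subsetGF (after true)) i
    ≡⟨ cong₂ _+_ (subsetGF-split (after false) i) (shift-cong 1 (subsetGF-split (after true)) i) ⟩
  (tail false false ⊕ shift 1 (tail false true)) i + shift 1 (tail true false ⊕ shift 1 (tail true true)) i
    ≡⟨ cong₂ _+_ (cong₂ _+_ (term false false i) (shift-cong 1 (term false true) i))
                 (shift-cong 1 (λ j → cong₂ _+_ (term true false j) (shift-cong 1 (term true true) j)) i) ⟩
  cycleGF k i ∎
  where
  open ≡-Reasoning
  after : Bool → Subset (1 + k) → Bool
  after b₀ D = cycleDominated (b₀ ∷ D)
  tail : Bool → Bool → Poly
  tail b₀ b₁ = tailGF b₀ b₁ k b₀ b₁
  term : ∀ b₀ b₁ → tail b₀ b₁ ≗ cycleTerm k b₀ b₁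
  term b₀ b₁ = tailGF-transfer b₀ b₁ k b₀ b₁

T-injective : ∀ {x y} → T x ⇔ T y → x ≡ y
T-injective T⇔T = ⇔→≡ (T-≡ ⇔-∘ (T⇔T ⇔-∘ ⇔-sym T-≡))

T-allFin : ∀ {n} (f : Fin n → Bool) → T (allFin f) ⇔ (∀ v → T (f v))
T-allFin {zero}  f = mk⇔ (λ _ ()) (λ _ → tt)
T-allFin {suc n} f = mk⇔
  (λ t → let (t₀ , tₛ) = to T-∧ t
         in λ { Fin.zero → t₀ ; (Fin.suc v) → to (T-allFin (f ∘ Fin.suc)) tₛ v })
  (λ h → from T-∧ (h Fin.zero , from (T-allFin (f ∘ Fin.suc)) (h ∘ Fin.suc)))

T-anyFin : ∀ {n} (f : Fin n → Bool) → T (anyFin f) ⇔ ∃ λ v → T (f v)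
T-anyFin {zero}  f = mk⇔ (λ ()) (λ ())
T-anyFin {suc n} f = mk⇔ forward backward
  where
  forward : T (anyFin f) → ∃ λ v → T (f v)
  forward t with to T-∨ t
  ... | inj₁ t₀ = Fin.zero , t₀
  ... | inj₂ tₛ = let (v , tᵥ) = to (T-anyFin (f ∘ Fin.suc)) tₛ in Fin.suc v , tᵥ
  backward : (∃ λ v → T (f v)) → T (anyFin f)
  backward (Fin.zero  , t) = from T-∨ (inj₁ t)
  backward (Fin.suc v , t) = from T-∨ (inj₂ (from (T-anyFin (f ∘ Fin.suc)) (v , t)))

bit : ∀ {n} → Subset n → ℕ → Bool
bit []      _       = false
bit (b ∷ _) zero    = b
bit (_ ∷ D) (suc j) = bit D j

member-bit : ∀ {n} (u : Fin n) (D : Subset n) → member u D ≡ bit D (toℕ u)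
member-bit Fin.zero    (b ∷ D) = refl
member-bit (Fin.suc u) (b ∷ D) = member-bit u D

T-tailDominated : ∀ {k} s₀ s₁ p q (rest : Subset k) → let w = p ∷ q ∷ rest in
  T (tailDominated s₀ s₁ p q rest) ⇔
    ((∀ j → j < k → T (bit w j ∨ bit w (2 + j))) × T (bit w k ∨ s₀) × T (bit w (1 + k) ∨ s₁))
T-tailDominated s₀ s₁ p q []         = mk⇔ (λ t → (λ _ ()) , to T-∧ t) (λ (_ , ends) → from T-∧ ends)
T-tailDominated s₀ s₁ p q (r ∷ rest) = mk⇔
  (λ t → let (t₀ , tₛ) = to T-∧ t ; (inner , ends) = to (T-tailDominated s₀ s₁ q r rest) tₛ
         in (λ { zero _ → t₀ ; (suc j) (s≤s j<k) → inner j j<k }) , ends)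
  (λ (inner , ends) → from T-∧
     (inner 0 (s≤s z≤n) , from (T-tailDominated s₀ s₁ q r rest) ((λ j j<k → inner (suc j) (s≤s j<k)) , ends)))

module Cycle (m : ℕ) where

  N : ℕ
  N = 3 + m

  next : ℕ → ℕ
  next v = suc v % N

  prev : ℕ → ℕ
  prev zero    = 2 + m
  prev (suc v) = v

  prev<N : ∀ {v} → v < N → prev v < N
  prev<N {zero}  _         = ≤-refl
  prev<N {suc v} (s≤s v<N) = m≤n⇒m≤1+n v<N

  next-prev : ∀ {v} → v < N → next (prev v) ≡ v
  next-prev {zero}  _   = n%n≡0 N
  next-prev {suc v} v<N = m<n⇒m%n≡m v<N

  prev-next : ∀ {u} → u < N → prev (next u) ≡ u
  prev-next {u} (s≤s u≤) with m≤n⇒m<n∨m≡n u≤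
  ... | inj₁ u<  = cong prev (m<n⇒m%n≡m (s≤s u<))
  ... | inj₂ refl = cong prev (n%n≡0 N)

  T-cycleAdj : ∀ (v u : Fin N) → T (cycleAdj N v u) ⇔ (toℕ u ≡ next (toℕ v) ⊎ toℕ u ≡ prev (toℕ v))
  T-cycleAdj v u = mk⇔ forward backward
    where
    forward : T (cycleAdj N v u) → toℕ u ≡ next (toℕ v) ⊎ toℕ u ≡ prev (toℕ v)
    forward t with to T-∨ t
    ... | inj₁ t₁ = inj₁ (sym (≡ᵇ⇒≡ (next (toℕ v)) (toℕ u) t₁))
    ... | inj₂ t₂ = inj₂ (trans (sym (prev-next (toℕ<n u)))
                                (cong prev (≡ᵇ⇒≡ (next (toℕ u)) (toℕ v) t₂)))
    backward : toℕ u ≡ next (toℕ v) ⊎ toℕ u ≡ prev (toℕ v) → T (cycleAdj N v u)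
    backward (inj₁ u≡) = from T-∨ (inj₁ (≡⇒≡ᵇ _ _ (sym u≡)))
    backward (inj₂ u≡) = from T-∨ (inj₂ (≡⇒≡ᵇ _ _ (trans (cong next u≡) (next-prev (toℕ<n v)))))

  window : Subset N → ℕ → Bool
  window D v = bit D (prev v) ∨ bit D (next v)

  chosenNeighbour : Subset N → Fin N → Fin N → Bool
  chosenNeighbour D v u = member u D ∧ cycleAdj N v u

  T-neighbourhood : ∀ D (v : Fin N) → T (anyFin (chosenNeighbour D v)) ⇔ T (window D (toℕ v))
  T-neighbourhood D v = mk⇔ forward backward
    where
    chosen : ∀ {u} → T (member u D) → T (bit D (toℕ u))
    chosen {u} = subst T (member-bit u D)
    forward : T (anyFin (chosenNeighbour D v)) → T (window D (toℕ v))
    forward t with to (T-anyFin (chosenNeighbour D v)) t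
    ... | u , tᵤ with to T-∧ tᵤ
    ...   | t-mem , t-adj with to (T-cycleAdj v u) t-adj
    ...     | inj₁ u≡ = from T-∨ (inj₂ (subst (T ∘ bit D) u≡ (chosen t-mem)))
    ...     | inj₂ u≡ = from T-∨ (inj₁ (subst (T ∘ bit D) u≡ (chosen t-mem)))
    witness : ∀ u → toℕ u ≡ next (toℕ v) ⊎ toℕ u ≡ prev (toℕ v) → T (bit D (toℕ u)) →
              T (anyFin (chosenNeighbour D v))
    witness u adj t = from (T-anyFin (chosenNeighbour D v))
      (u , from T-∧ (subst T (sym (member-bit u D)) t , from (T-cycleAdj v u) adj))
    backward : T (window D (toℕ v)) → T (anyFin (chosenNeighbour D v))
    backward t with to T-∨ t
    ... | inj₁ t-prev = let eq = toℕ-fromℕ< (prev<N (toℕ<n v)) in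
                        witness (fromℕ< (prev<N (toℕ<n v))) (inj₂ eq) (subst (T ∘ bit D) (sym eq) t-prev)
    ... | inj₂ t-next = let eq = toℕ-fromℕ< (m%n<n (suc (toℕ v)) N) in
                        witness (fromℕ< (m%n<n (suc (toℕ v)) N)) (inj₁ eq) (subst (T ∘ bit D) (sym eq) t-next)

  T-isTotalDominating : ∀ D → T (isTotalDominating (C N) D) ⇔ (∀ v → v < N → T (window D v))
  T-isTotalDominating D = mk⇔
    (λ t v v<N → subst (T ∘ window D) (toℕ-fromℕ< v<N)
                   (to (T-neighbourhood D (fromℕ< v<N)) (to T-all t (fromℕ< v<N))))
    (λ h → from T-all (λ v → from (T-neighbourhood D v) (h (toℕ v) (toℕ<n v))))
    where T-all = T-allFin (anyFin ∘ chosenNeighbour D)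

  window-≡ : ∀ D v {w} → next v ≡ w → window D v ≡ bit D (prev v) ∨ bit D w
  window-≡ D v = cong (λ w → bit D (prev v) ∨ bit D w)

  next-first : next 0 ≡ 1
  next-first = m<n⇒m%n≡m {n = N} (s≤s (s≤s z≤n))

  next-inner : ∀ {j} → j < suc m → next (suc j) ≡ 2 + j
  next-inner j<k = m<n⇒m%n≡m (s≤s (s≤s j<k))

  next-last : next (2 + m) ≡ 0
  next-last = n%n≡0 N

  windows⇔cycleDominated : ∀ D → (∀ v → v < N → T (window D v)) ⇔ T (cycleDominated D)
  windows⇔cycleDominated D@(b₀ ∷ b₁ ∷ rest) = mk⇔ forward backward
    where
    forward : (∀ v → v < N → T (window D v)) → T (cycleDominated D)
    forward h = from (T-tailDominated b₀ b₁ b₀ b₁ rest)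
      ( (λ j j<k → subst T (window-≡ D (suc j) (next-inner j<k)) (h (suc j) (s≤s (m≤n⇒m≤1+n j<k))))
      , subst T (window-≡ D (2 + m) next-last) (h (2 + m) ≤-refl)
      , subst T (window-≡ D 0 next-first) (h 0 (s≤s z≤n)) )
    backward : T (cycleDominated D) → ∀ v → v < N → T (window D v)
    backward t = windowAt
      where
      windowAt : ∀ v → v < N → T (window D v)
      windowAt v v<N with to (T-tailDominated b₀ b₁ b₀ b₁ rest) t | v | v<N
      ... | _ , _ , first | zero | _ = subst T (sym (window-≡ D 0 next-first)) first
      ... | inner , last , _ | suc j | s≤s j≤ with m≤n⇒m<n∨m≡n j≤
      ...   | inj₁ (s≤s j<k) = subst T (sym (window-≡ D (suc j) (next-inner j<k))) (inner j j<k)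
      ...   | inj₂ refl      = subst T (sym (window-≡ D (2 + m) next-last)) last

  isTotalDominating-cycle : ∀ D → isTotalDominating (C N) D ≡ cycleDominated D
  isTotalDominating-cycle D = T-injective (windows⇔cycleDominated D ⇔-∘ T-isTotalDominating D)

Dt-coeff-cycle : ∀ m → Dt-coeff (C (3 + m)) ≗ cycleGF (1 + m)
Dt-coeff-cycle m zero    = refl
Dt-coeff-cycle m (suc i) =
  trans (subsetGF-cong (Cycle.isTotalDominating-cycle m) (suc i)) (subsetGF-cycleDominated (1 + m) (suc i))

theorem4 : (n : ℕ) → n ≥ 7 → (i : ℕ) →
    Dt-coeff (C n) i ≡
    shift 1 (Dt-coeff (C (n ∸ 1))) i + shift 2 (Dt-coeff (C (n ∸ 3))) i + shift 2 (Dt-coeff (C (n ∸ 4))) i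
theorem4 (suc (suc (suc (suc (suc (suc (suc m))))))) (s≤s (s≤s (s≤s (s≤s (s≤s (s≤s (s≤s _))))))) i = begin
  Dt-coeff (C (7 + m)) i
    ≡⟨ Dt-coeff-cycle (4 + m) i ⟩
  cycleGF (5 + m) i
    ≡⟨ cycleGF-recurrent (1 + m) i ⟩
  shift 1 (cycleGF (4 + m)) i + shift 2 (cycleGF (2 + m)) i + shift 2 (cycleGF (1 + m)) i
    ≡⟨ cong₂ _+_ (cong₂ _+_ (shift-cong 1 (Dt-coeff-cycle (3 + m)) i) (shift-cong 2 (Dt-coeff-cycle (1 + m)) i))
                 (shift-cong 2 (Dt-coeff-cycle m) i) ⟨
  shift 1 (Dt-coeff (C (6 + m))) i + shift 2 (Dt-coeff (C (4 + m))) i + shift 2 (Dt-coeff (C (3 + m))) i ∎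
  where open ≡-Reasoning
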